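{- For every digraph $F$ that is $\delta^0$-maderian, $\mathrm{mad}_{\vec{\chi}}(F)\le \mathrm{mad}_{\delta^0}(F)+1$.
   Context: Digraphs are finite. $\vec{\chi}(D)$ is the least $k$ such that $V(D)$ can be partitioned into $k$ sets each inducing an acyclic subdigraph. $\delta^0(D)=\min\{\delta^+(D),\delta^-(D)\}$ (minimum out-degree and in-degree). A subdivision of $F$ is obtained by replacing each arc $(u,v)$ by a directed $(u,v)$-path of length at least 1, internally disjoint; $D$ contains a subdivision of $F$ if some subdigraph of $D$ is one. For $\gamma\in\{\vec{\chi},\delta^0\}$, $F$ is $\gamma$-maderian if there is an integer $c$ such that every $D$ with $\gamma(D)\ge c$ contains a subdivision of $F$, and $\mathrm{mad}_\gamma(F)$ is the least such $c$. -}

module Defs where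

open import Data.Nat using (ℕ; zero; suc; _≤_; _<_; _⊓_)
open import Data.Fin using (Fin) renaming (zero to fzero; suc to fsuc)
open import Data.Bool using (Bool; true; false)
open import Data.List using (List; []; _∷_; _++_; [_]; length; filterᵇ; allFin)
open import Data.List.Relation.Unary.All using (All)
open import Data.List.Relation.Unary.Unique.Propositional using (Unique)
open import Data.List.Membership.Propositional using (_∈_; _∉_)
open import Data.Product using (Σ; ∃; _×_)
open import Data.Unit using (⊤)
open import Data.Empty using (⊥)
open import Relation.Nullary using (¬_)
open import Relation.Binary.PropositionalEquality using (_≡_)

-- A finite digraph: vertex set Fin n, arc relation as a Boolean adjacency
-- matrix (no parallel arcs), no loops. Digons (u→v and v→u) are allowed.
record Digraph : Set where
  field
    n        : ℕ
    arc      : Fin n → Fin n → Bool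
    loopless : ∀ v → arc v v ≡ false
open Digraph public

Chain : (D : Digraph) → List (Fin (n D)) → Set
Chain D []            = ⊤
Chain D (x ∷ [])      = ⊤
Chain D (x ∷ y ∷ r)   = (arc D x y ≡ true) × Chain D (y ∷ r)

InducesAcyclic : (D : Digraph) → (Fin (n D) → Set) → Set
InducesAcyclic D P =
  ∀ (x : Fin (n D)) (rest : List (Fin (n D))) →
    All P (x ∷ rest) → Unique (x ∷ rest) → Chain D ((x ∷ rest) ++ [ x ]) → ⊥

AcyclicColourable : Digraph → ℕ → Set
AcyclicColourable D k =
  Σ (Fin (n D) → Fin k) λ f → ∀ (i : Fin k) → InducesAcyclic D (λ v → f v ≡ i)

DichromaticAtLeast : Digraph → ℕ → Set
DichromaticAtLeast D c = ∀ k → k < c → ¬ AcyclicColourable D k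

outdeg : (D : Digraph) → Fin (n D) → ℕ
outdeg D v = length (filterᵇ (λ w → arc D v w) (allFin (n D)))

indeg : (D : Digraph) → Fin (n D) → ℕ
indeg D v = length (filterᵇ (λ w → arc D w v) (allFin (n D)))

-- Minimum of a function over Fin m (0 for the empty digraph, by convention).
minOver : (m : ℕ) → (Fin m → ℕ) → ℕ
minOver zero          f = 0
minOver (suc zero)    f = f fzero
minOver (suc (suc m)) f = f fzero ⊓ minOver (suc m) (λ i → f (fsuc i))

δ⁰ : Digraph → ℕ
δ⁰ D = minOver (n D) (λ v → outdeg D v ⊓ indeg D v)

MinSemiDegreeAtLeast : Digraph → ℕ → Set
MinSemiDegreeAtLeast D c = c ≤ δ⁰ D

-- D contains a subdivision of F: injective branch map, and for every arc (u,v)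
-- of F a directed path in D from branch u to branch v (given by its list of
-- internal vertices), the paths being internally disjoint and their internal
-- vertices avoiding the branch vertices.
record SubdivisionIn (D F : Digraph) : Set where
  field
    branch       : Fin (n F) → Fin (n D)
    branch-inj   : ∀ u v → branch u ≡ branch v → u ≡ v
    inner        : (u v : Fin (n F)) → arc F u v ≡ true → List (Fin (n D))
    isWalk       : ∀ u v (p : arc F u v ≡ true) →
                     Chain D ((branch u ∷ inner u v p) ++ [ branch v ])
    isPath       : ∀ u v (p : arc F u v ≡ true) →
                     Unique ((branch u ∷ inner u v p) ++ [ branch v ])
    avoidBranch  : ∀ u v (p : arc F u v ≡ true) w → branch w ∉ inner u v p
    disjoint     : ∀ u v (p : arc F u v ≡ true) u' v' (p' : arc F u' v' ≡ true) x →
                     x ∈ inner u v p → x ∈ inner u' v' p' → (u ≡ u') × (v ≡ v')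

ContainsSubdivision : Digraph → Digraph → Set
ContainsSubdivision D F = SubdivisionIn D F

-- Generic γ-notions, where  G D c  means  γ(D) ≥ c.
Forces : (Digraph → ℕ → Set) → Digraph → ℕ → Set
Forces G F c = ∀ (D : Digraph) → G D c → ContainsSubdivision D F

Maderian : (Digraph → ℕ → Set) → Digraph → Set
Maderian G F = ∃ λ c → Forces G F c

IsMad : (Digraph → ℕ → Set) → Digraph → ℕ → Set
IsMad G F m = Forces G F m × (∀ k → k < m → ¬ Forces G F k)

-- A digraph with χ⃗ ≥ m + 1 contains a subdigraph with δ⁰ ≥ m, into which F subdivides
-- by the definition of mad_δ⁰(F) = m.  To find it, delete vertices of out- or in-degree
-- less than m as long as there are any: this never creates an acyclic m-colouring,
-- because every directed cycle through a deleted vertex v passes through an out-neighbour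
-- and through an in-neighbour of v, so v can be given a colour missing on the fewer than
-- m vertices of one of these neighbourhoods.
module Submission where

open import Defs
open import Data.Nat using (ℕ; suc; _≤_)
open import Data.Product using (_×_)

open import Data.Nat using (zero; _<_; _⊓_; _≤?_)
open import Data.Nat.Properties using (⊓-sel; ≰⇒>; ≮⇒≥; n<1+n)
open import Data.Nat.Induction using (<-wellFounded)
open import Induction.WellFounded using (Acc; acc)
open import Data.Fin using (Fin; punchIn; punchOut) renaming (zero to fzero; suc to fsuc)
open import Data.Fin.Properties
  using (_≟_; pigeonhole; <-irrefl; ¬∀⟶∃¬; punchIn-injective; punchIn-punchOut)
open import Data.Vec.Functional using (insertAt)
open import Data.Vec.Functional.Properties using (insertAt-lookup; insertAt-punchIn)
open import Data.Bool using (Bool; true; false; T)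
open import Data.Bool.Properties using (T?)
open import Data.Unit using (tt)
open import Data.Empty using (⊥; ⊥-elim)
open import Data.Sum using (_⊎_; inj₁; inj₂)
open import Data.Product using (Σ; ∃; _,_; proj₁; proj₂)
open import Data.List using (List; []; _∷_; _++_; [_]; length; map; filterᵇ; allFin; lookup)
open import Data.List.Properties using (map-++; length-map)
open import Data.List.Relation.Unary.All as All using (All; _∷_)
open import Data.List.Relation.Unary.All.Properties as All using ()
open import Data.List.Relation.Unary.Any as Any using (Any; here; there)
open import Data.List.Relation.Unary.Any.Properties as Any using (lookup-index)
open import Data.List.Relation.Unary.Unique.Propositional using (Unique)
open import Data.List.Relation.Unary.Unique.Propositional.Properties as Unique using ()
open import Data.List.Membership.Propositional using (_∈_; _∉_; find)
open import Data.List.Membership.Propositional.Properties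
  using (∈-map⁺; ∈-map⁻; ∈-filter⁺; ∈-allFin; ∈-++⁺ˡ; ∈-++⁺ʳ)
open import Function using (_∘_)
open import Relation.Nullary using (¬_; yes; no)
open import Relation.Binary.PropositionalEquality
  using (_≡_; _≢_; refl; sym; trans; cong; subst; module ≡-Reasoning)

record Embedding (D' D : Digraph) : Set where
  field
    vertex           : Fin (n D') → Fin (n D)
    vertex-injective : ∀ {x y} → vertex x ≡ vertex y → x ≡ y
    arc-preserving   : ∀ {i j} → arc D' i j ≡ true → arc D (vertex i) (vertex j) ≡ true
open Embedding

Embedding-id : ∀ {D} → Embedding D D
Embedding-id = record { vertex = λ x → x ; vertex-injective = λ p → p ; arc-preserving = λ p → p }

_∘ᴱ_ : ∀ {A B C} → Embedding B C → Embedding A B → Embedding A C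
G ∘ᴱ E = record
  { vertex           = vertex G ∘ vertex E
  ; vertex-injective = vertex-injective E ∘ vertex-injective G
  ; arc-preserving   = arc-preserving G ∘ arc-preserving E
  }

ArcReflecting : ∀ {D' D} → Embedding D' D → Set
ArcReflecting {D'} {D} E =
  ∀ {i j} → arc D (vertex E i) (vertex E j) ≡ true → arc D' i j ≡ true

Chain-map : ∀ {D' D} (E : Embedding D' D) xs → Chain D' xs → Chain D (map (vertex E) xs)
Chain-map E []          _       = tt
Chain-map E (x ∷ [])    _       = tt
Chain-map E (x ∷ y ∷ r) (p , c) = arc-preserving E p , Chain-map E (y ∷ r) c

Chain-unmap : ∀ {D' D} (E : Embedding D' D) → ArcReflecting E →
              ∀ xs → Chain D (map (vertex E) xs) → Chain D' xs
Chain-unmap E reflects []          _       = tt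
Chain-unmap E reflects (x ∷ [])    _       = tt
Chain-unmap E reflects (x ∷ y ∷ r) (p , c) = reflects p , Chain-unmap E reflects (y ∷ r) c

SubdivisionIn-map : ∀ {D' D F} → Embedding D' D → SubdivisionIn D' F → SubdivisionIn D F
SubdivisionIn-map {D'} {D} {F} E S = record
  { branch      = e ∘ branch
  ; branch-inj  = λ u v → branch-inj u v ∘ vertex-injective E
  ; inner       = λ u v p → map e (inner u v p)
  ; isWalk      = λ u v p → subst (Chain D) (path-map u v p) (Chain-map E _ (isWalk u v p))
  ; isPath      = λ u v p → subst Unique (path-map u v p)
                              (Unique.map⁺ (vertex-injective E) (isPath u v p))
  ; avoidBranch = avoids
  ; disjoint    = disjoint-map
  }
  where
  open SubdivisionIn S
  e = vertex E

  path-map : ∀ u v (p : arc F u v ≡ true) →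
             map e ((branch u ∷ inner u v p) ++ [ branch v ]) ≡
             (e (branch u) ∷ map e (inner u v p)) ++ [ e (branch v) ]
  path-map u v p = map-++ e (branch u ∷ inner u v p) [ branch v ]

  unmap-∈ : ∀ {x xs} → e x ∈ map e xs → x ∈ xs
  unmap-∈ {xs = xs} ex∈ with ∈-map⁻ e ex∈
  ... | y , y∈ , ex≡ey = subst (_∈ xs) (sym (vertex-injective E ex≡ey)) y∈

  avoids : ∀ u v (p : arc F u v ≡ true) w → e (branch w) ∉ map e (inner u v p)
  avoids u v p w = avoidBranch u v p w ∘ unmap-∈

  disjoint-map : ∀ u v (p : arc F u v ≡ true) u' v' (p' : arc F u' v' ≡ true) x →
                 x ∈ map e (inner u v p) → x ∈ map e (inner u' v' p') → (u ≡ u') × (v ≡ v')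
  disjoint-map u v p u' v' p' x x∈ x∈' with ∈-map⁻ e x∈
  ... | y , y∈ , refl = disjoint u v p u' v' p' y y∈ (unmap-∈ x∈')

map-preimage : ∀ {A B : Set} (f : A → B) {xs} →
               All (λ b → ∃ λ a → f a ≡ b) xs → ∃ λ ys → map f ys ≡ xs
map-preimage f All.[]               = [] , refl
map-preimage f ((a , refl) ∷ preimages) with map-preimage f preimages
... | ys , refl = a ∷ ys , refl

InducesAcyclic-mono : ∀ {D} {P Q : Fin (n D) → Set} →
                      (∀ {w} → P w → Q w) → InducesAcyclic D Q → InducesAcyclic D P
InducesAcyclic-mono P⇒Q acyclic x rest all = acyclic x rest (All.map P⇒Q all)

InducesAcyclic-image : ∀ {D' D} (E : Embedding D' D) → ArcReflecting E →
                       ∀ {P : Fin (n D) → Set} → InducesAcyclic D' (P ∘ vertex E) →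
                       InducesAcyclic D (λ w → P w × ∃ λ y → vertex E y ≡ w)
InducesAcyclic-image {D = D} E reflects acyclic x rest all unique closed
  with map-preimage (vertex E) (All.map proj₂ all)
... | y ∷ ys , refl =
  acyclic y ys (All.map⁻ (All.map proj₁ all)) (Unique.map⁻ unique)
    (Chain-unmap E reflects ((y ∷ ys) ++ [ y ])
      (subst (Chain D) (sym (map-++ (vertex E) (y ∷ ys) [ y ])) closed))

_─_ : (D : Digraph) → Fin (n D) → Digraph
record { n = suc k ; arc = a ; loopless = l } ─ v = record
  { n        = k
  ; arc      = λ i j → a (punchIn v i) (punchIn v j)
  ; loopless = λ i → l (punchIn v i)
  }

─-embedding : ∀ D v → Embedding (D ─ v) D
─-embedding record { n = suc k } v = record
  { vertex = punchIn v ; vertex-injective = punchIn-injective v _ _ ; arc-preserving = λ p → p }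

─-arc-reflecting : ∀ D v → ArcReflecting (─-embedding D v)
─-arc-reflecting record { n = suc k } v p = p

─-image : ∀ D v {w} → v ≢ w → ∃ λ y → vertex (─-embedding D v) y ≡ w
─-image record { n = suc k } v v≢w = punchOut v≢w , punchIn-punchOut v≢w

chain-successor : ∀ {D} xs z {v} → v ∈ xs → Chain D (xs ++ [ z ]) →
                  Any (λ w → arc D v w ≡ true) (xs ++ [ z ])
chain-successor (x ∷ [])     z (here refl) (p , _) = there (here p)
chain-successor (x ∷ y ∷ xs) z (here refl) (p , _) = there (here p)
chain-successor (x ∷ y ∷ xs) z (there v∈) (_ , c) = there (chain-successor (y ∷ xs) z v∈ c)

chain-predecessor : ∀ {D} x ys {v} → v ∈ ys → Chain D (x ∷ ys) →
                    Any (λ w → arc D w v ≡ true) (x ∷ ys)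
chain-predecessor x (y ∷ ys) (here refl) (p , _) = here p
chain-predecessor x (y ∷ ys) (there v∈)  (_ , c) = there (chain-predecessor y ys v∈ c)

MeetsEveryCycleThrough : (D : Digraph) → Fin (n D) → (Fin (n D) → Bool) → Set
MeetsEveryCycleThrough D v S =
  ∀ x rest → v ∈ x ∷ rest → Chain D ((x ∷ rest) ++ [ x ]) → Any (λ w → S w ≡ true) (x ∷ rest)

out-neighbours-meet-cycles : ∀ D v → MeetsEveryCycleThrough D v (arc D v)
out-neighbours-meet-cycles D v x rest v∈ closed
  with Any.++⁻ (x ∷ rest) (chain-successor (x ∷ rest) x v∈ closed)
... | inj₁ p        = p
... | inj₂ (here p) = here p

in-neighbours-meet-cycles : ∀ D v → MeetsEveryCycleThrough D v (λ w → arc D w v)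
in-neighbours-meet-cycles D v x rest v∈ closed
  with chain-predecessor x (rest ++ [ x ]) (rotate v∈) closed
  where
  rotate : v ∈ x ∷ rest → v ∈ rest ++ [ x ]
  rotate (here v≡x) = ∈-++⁺ʳ rest (here v≡x)
  rotate (there v∈) = ∈-++⁺ˡ v∈
... | here p = here p
... | there p with Any.++⁻ rest p
...   | inj₁ q        = there q
...   | inj₂ (here q) = here q

missing-element : ∀ {m} (xs : List (Fin m)) → length xs < m → ∃ λ i → i ∉ xs
missing-element {m} xs |xs|<m =
  ¬∀⟶∃¬ m (_∈ xs) (λ i → Any.any? (i ≟_) xs) λ covers →
    let i , j , i<j , same-index = pigeonhole |xs|<m (Any.index ∘ covers)
    in <-irrefl (trans (lookup-index (covers i))
                  (trans (cong (lookup xs) same-index) (sym (lookup-index (covers j))))) i<j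

insertAt-≢ : ∀ {A : Set} {k} (xs : Fin k → A) (v : Fin (suc k)) x y {w} →
             v ≢ w → insertAt xs v x w ≡ insertAt xs v y w
insertAt-≢ xs v x y v≢w =
  subst (λ u → insertAt xs v x u ≡ insertAt xs v y u) (punchIn-punchOut v≢w)
    (trans (insertAt-punchIn xs v x _) (sym (insertAt-punchIn xs v y _)))

colouring-extends : ∀ {m} D v (S : Fin (n D) → Bool) → S v ≡ false →
                    length (filterᵇ S (allFin (n D))) < m → MeetsEveryCycleThrough D v S →
                    AcyclicColourable (D ─ v) m → AcyclicColourable D m
colouring-extends {zero} _ _ _ _ () _ _
colouring-extends {suc _} D@record { n = suc k } v S Sv≡false |S|<m meets (c , c-acyclic) =
  colour , colour-acyclic
  where
  L = filterᵇ S (allFin (suc k))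
  -- The colour given to v here is irrelevant: v ∉ L because S v ≡ false.
  default = insertAt c v fzero
  free = missing-element (map default L) (subst (_< _) (sym (length-map default L)) |S|<m)
  i = proj₁ free
  colour = insertAt c v i

  colour-acyclic : ∀ j → InducesAcyclic D (λ w → colour w ≡ j)
  colour-acyclic j x rest all unique closed with Any.any? (v ≟_) (x ∷ rest)
  ... | no v∉ =
    InducesAcyclic-image (─-embedding D v) (─-arc-reflecting D v)
      (InducesAcyclic-mono (trans (sym (insertAt-punchIn c v i _))) (c-acyclic j))
      x rest (All.tabulate λ w∈ → All.lookup all w∈ , ─-image D v λ { refl → v∉ w∈ })
      unique closed
  ... | yes v∈ = colour-clash (find (meets x rest v∈ closed))
    where
    colour-clash : (∃ λ w → w ∈ x ∷ rest × S w ≡ true) → ⊥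
    colour-clash (w , w∈ , Sw) =
      proj₂ free (subst (_∈ map default L) default-w≡i (∈-map⁺ default w∈L))
      where
      w∈L : w ∈ L
      w∈L = ∈-filter⁺ (T? ∘ S) (∈-allFin w) (subst T (sym Sw) tt)
      v≢w : v ≢ w
      v≢w v≡w = subst T Sv≡false (subst (T ∘ S) (sym v≡w) (subst T (sym Sw) tt))
      default-w≡i : default w ≡ i
      default-w≡i = begin
        default w  ≡⟨ insertAt-≢ c v fzero i v≢w ⟩
        colour w   ≡⟨ All.lookup all w∈ ⟩
        j          ≡⟨ sym (All.lookup all v∈) ⟩
        colour v   ≡⟨ insertAt-lookup c v i ⟩
        i          ∎
        where open ≡-Reasoning

⊓-<-split : ∀ {x y m} → x ⊓ y < m → x < m ⊎ y < m
⊓-<-split {x} {y} x⊓y<m with ⊓-sel x y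
... | inj₁ x⊓y≡x = inj₁ (subst (_< _) x⊓y≡x x⊓y<m)
... | inj₂ x⊓y≡y = inj₂ (subst (_< _) x⊓y≡y x⊓y<m)

deletion-keeps-non-colourable : ∀ {m} D v → outdeg D v ⊓ indeg D v < m →
                                ¬ AcyclicColourable D m → ¬ AcyclicColourable (D ─ v) m
deletion-keeps-non-colourable D v deg<m ¬colourable with ⊓-<-split deg<m
... | inj₁ out<m = ¬colourable ∘ colouring-extends D v (arc D v) (loopless D v)
                                   out<m (out-neighbours-meet-cycles D v)
... | inj₂ in<m  = ¬colourable ∘ colouring-extends D v (λ w → arc D w v) (loopless D v)
                                   in<m (in-neighbours-meet-cycles D v)

minOver-<⇒ : ∀ k (f : Fin (suc k) → ℕ) {m} → minOver (suc k) f < m → ∃ λ i → f i < m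
minOver-<⇒ zero    f min<m = fzero , min<m
minOver-<⇒ (suc k) f min<m with ⊓-<-split {f fzero} min<m
... | inj₁ f0<m = fzero , f0<m
... | inj₂ rest<m with minOver-<⇒ k (f ∘ fsuc) rest<m
...   | i , fi<m = fsuc i , fi<m

critical-subdigraph : ∀ m D → ¬ AcyclicColourable D m →
                      Σ Digraph λ D' → MinSemiDegreeAtLeast D' m × Embedding D' D
critical-subdigraph m D = go D (<-wellFounded (n D))
  where
  go : ∀ D → Acc _<_ (n D) → ¬ AcyclicColourable D m →
       Σ Digraph λ D' → MinSemiDegreeAtLeast D' m × Embedding D' D
  go record { n = zero } _ ¬colourable = ⊥-elim (¬colourable ((λ ()) , λ _ ()))
  go D@record { n = suc k } (acc smaller) ¬colourable with m ≤? δ⁰ D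
  ... | yes m≤δ⁰ = D , m≤δ⁰ , Embedding-id
  ... | no m≰δ⁰ with minOver-<⇒ k _ (≰⇒> m≰δ⁰)
  ...   | v , deg<m with go (D ─ v) (smaller (n<1+n k))
                          (deletion-keeps-non-colourable D v deg<m ¬colourable)
  ...     | D' , m≤δ⁰' , E = D' , m≤δ⁰' , ─-embedding D v ∘ᴱ E

dichromatic-forces : ∀ {F m} → Forces MinSemiDegreeAtLeast F m →
                     Forces DichromaticAtLeast F (suc m)
dichromatic-forces {m = m} forces D χ⃗≥ with critical-subdigraph m D (χ⃗≥ m (n<1+n m))
... | D' , δ⁰≥ , E = SubdivisionIn-map E (forces D' δ⁰≥)

IsMad-≤ : ∀ {G F m c} → IsMad G F m → Forces G F c → m ≤ c
IsMad-≤ (_ , minimal) forces = ≮⇒≥ λ c<m → minimal _ c<m forces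

corollary34 : (F : Digraph) → Maderian MinSemiDegreeAtLeast F →
    (m : ℕ) → IsMad MinSemiDegreeAtLeast F m →
    Maderian DichromaticAtLeast F
      × (∀ m' → IsMad DichromaticAtLeast F m' → m' ≤ suc m)
corollary34 F _ m (forces , _) =
  (suc m , dichromatic-forces forces) , λ m' mad → IsMad-≤ mad (dichromatic-forces forces)
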